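{- Let $f(r)=0$ for $r\le1$ and $f(r)=\frac{r(r-1)}{r(r-1)+1}$ for $r>1$. Consider the online multiprocessor scheduling with uniform testing problem (all $t_j=1$). For any randomized algorithm that tests each job $J_j$ with probability $f(u_j/t_j)$, independently of the other jobs (with arbitrary machine assignment), its expected competitive ratio on $m$ machines is unbounded as $m\to\infty$, i.e., for every $K>0$ there exist $m$ and an instance on $m$ machines with $E[C(I)]/C^*(I)>K$.
   Context: Online multiprocessor scheduling with testing on $m$ identical parallel machines: jobs $J_1,\dots,J_n$ arrive one by one. When $J_j$ arrives, an upper bound $u_j\ge0$ and a testing time $t_j$ are revealed (here $t_j=1$ for all $j$); its processing time $p_j\in[0,u_j]$ is unknown. Upon arrival the algorithm irrevocably decides whether to test $J_j$ and on which machine to process it. An untested job occupies its machine for $u_j$ time; a tested job for $t_j+p_j$ time. The makespan is the maximum machine load. With $\rho_j=\min\{u_j,t_j+p_j\}$, the optimal offline makespan $C^*(I)$ is the minimum over assignments of jobs to machines of the maximum over machines of the sum of $\rho_j$ of the jobs assigned to it. The expected competitive ratio of a randomized algorithm is $\sup_I E[C(I)]/C^*(I)$. -}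

module Defs where

open import Data.Nat using (ℕ; zero; suc)
open import Data.Fin as F using (Fin)
open import Data.Vec using (Vec; []; _∷_; lookup)
open import Data.List as L using (List; []; _∷_; map; concatMap; foldr)
open import Data.Bool using (Bool; true; false; if_then_else_)
open import Data.Rational using (ℚ; 0ℚ; 1ℚ; _+_; _*_; _-_; _÷_; _⊔_; _⊓_; ≢-nonZero)
open import Data.Rational.Properties using (_≤?_; _≟_)
open import Relation.Nullary using (yes; no)

-- total division on ℚ (x / 0 := 0); only ever used with nonzero denominators
_/'_ : ℚ → ℚ → ℚ
x /' y with y ≟ 0ℚ
... | yes _ = 0ℚ
... | no y≢0 = _÷_ x y {{≢-nonZero y≢0}}

f : ℚ → ℚ
f r with r ≤? 1ℚ
... | yes _ = 0ℚ
... | no _ = (r * (r - 1ℚ)) /' ((r * (r - 1ℚ)) + 1ℚ)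

allVecs : {A : Set} → List A → (n : ℕ) → List (Vec A n)
allVecs xs zero = [] ∷ []
allVecs xs (suc n) = concatMap (λ x → map (x ∷_) (allVecs xs n)) xs

allBool : List Bool
allBool = true ∷ false ∷ []

sumℚ : List ℚ → ℚ
sumℚ = foldr _+_ 0ℚ

-- maximum (of nonnegative quantities; empty list gives 0)
maxℚ : List ℚ → ℚ
maxℚ = foldr _⊔_ 0ℚ

-- minimum of a list (empty list gives 0; never used on empty lists when m ≥ 1)
minℚ : List ℚ → ℚ
minℚ [] = 0ℚ
minℚ (x ∷ xs) = foldr _⊓_ x xs

load : (m n : ℕ) → (Fin n → Fin m) → (Fin n → ℚ) → Fin m → ℚ
load m n σ c i = sumℚ (map (λ j → if F._≟_ (σ j) i .Relation.Nullary.Dec.does then c j else 0ℚ) (L.allFin n))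

makespan : (m n : ℕ) → (Fin n → Fin m) → (Fin n → ℚ) → ℚ
makespan m n σ c = maxℚ (map (load m n σ c) (L.allFin m))

-- ρ_j = min(u_j, t_j + p_j) with t_j = 1
ρ : {n : ℕ} → Vec ℚ n → Vec ℚ n → Fin n → ℚ
ρ u p j = lookup u j ⊓ (1ℚ + lookup p j)

Copt : (m n : ℕ) → Vec ℚ n → Vec ℚ n → ℚ
Copt m n u p = minℚ (map (λ σ → makespan m n (lookup σ) (ρ u p)) (allVecs (L.allFin m) n))

-- occupation time of job j given test decisions b (t_j = 1)
occ : {n : ℕ} → Vec ℚ n → Vec ℚ n → Vec Bool n → Fin n → ℚ
occ u p b j = if lookup b j then 1ℚ + lookup p j else lookup u j

-- probability of the test-decision vector b when job j is tested independently w.p. f(u_j/t_j) = f(u_j)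
prob : {n : ℕ} → Vec ℚ n → Vec Bool n → ℚ
prob [] [] = 1ℚ
prob (u ∷ us) (b ∷ bs) = (if b then f u else 1ℚ - f u) * prob us bs

-- expected makespan; the machine assignment σ may depend arbitrarily on all test decisions
ExpC : (m n : ℕ) → Vec ℚ n → Vec ℚ n → (Vec Bool n → Fin n → Fin m) → ℚ
ExpC m n u p σ = sumℚ (map (λ b → prob u b * makespan m n (σ b) (occ u p b)) (allVecs allBool n))

module Submission where

-- Take N = r(r − 1) + 1 identical jobs with u = r and p = 0 on N machines. Offline every job is
-- tested (ρ = 1) and gets its own machine, so C* = 1. Online each job is tested with probability
-- f(r) = 1 − 1/N, so by Bernoulli's inequality all of them are tested with probability
-- (1 − 1/N)^N ≤ 1/2, and otherwise an untested job alone occupies its machine for r. Hence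
-- E[C] ≥ r − (r − 1)/2 = (r + 1)/2, which exceeds K once r ≥ 2K.

open import Defs
open import Data.Nat using (ℕ)
open import Data.Fin using (Fin)
open import Data.Vec using (Vec; lookup)
open import Data.Bool using (Bool)
open import Data.Rational using (ℚ; 0ℚ; _*_; _<_; _≤_)
open import Data.Product using (Σ; ∃-syntax; _×_)
import Data.Nat as N

open import Algebra.Bundles using (Ring)
import Algebra.Properties.Semiring.Exp as SemiringExp
import Algebra.Properties.Semiring.Mult as SemiringMult
open import Data.Bool using (true; false; if_then_else_; _∧_)
open import Data.Empty using (⊥-elim)
open import Data.Fin using (zero; suc)
import Data.Fin as F
import Data.Integer as ℤ
import Data.Integer.Properties as ℤ
open import Data.List using (List; []; _∷_; map; _++_; foldr; tabulate; allFin)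
open import Data.List.Membership.Propositional using (_∈_)
open import Data.List.Membership.Propositional.Properties using (∈-map⁺; ∈-map⁻; ∈-concat⁺′; ∈-allFin)
open import Data.List.Properties using (map-∘; map-cong; map-tabulate; ++-identityʳ)
open import Data.List.Relation.Unary.Any using (here; there)
open import Data.Nat using (suc; s≤s; z≤n)
open import Data.Product using (_,_)
open import Data.Rational
  using (1ℚ; _+_; _-_; -_; _⊓_; 1/_; _÷_; mkℚ; toℚᵘ; *≤*; NonZero; ≢-nonZero; nonNegative; positive)
open import Data.Rational.Properties
open import Data.Rational.Solver using (module +-*-Solver)
import Data.Rational.Unnormalised as ℚᵘ
import Data.Rational.Unnormalised.Properties as ℚᵘ
open import Data.Vec using ([]; _∷_; replicate)
import Data.Vec as V
open import Data.Vec.Properties using (lookup-replicate; lookup∘tabulate)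
open import Function using (_∘_)
open import Relation.Binary.PropositionalEquality
open import Relation.Nullary using (yes; no; does; ¬_)
open import Relation.Nullary.Decidable using (dec-true)

open +-*-Solver

open SemiringMult (Ring.semiring +-*-ring) using (×-homo-+; ×1-homo-*) renaming (_×_ to _×ℕ_)
open SemiringExp (Ring.semiring +-*-ring) using (_^_)

p≤p+q : ∀ p {q} → 0ℚ ≤ q → p ≤ p + q
p≤p+q p {q} q≥0 = subst (_≤ p + q) (+-identityʳ p) (+-monoʳ-≤ p q≥0)

p≤q+p : ∀ p {q} → 0ℚ ≤ q → p ≤ q + p
p≤q+p p {q} q≥0 = subst (_≤ q + p) (+-identityˡ p) (+-monoˡ-≤ p q≥0)

p≤q⇒0≤q-p : ∀ {p q} → p ≤ q → 0ℚ ≤ q - p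
p≤q⇒0≤q-p {p} {q} p≤q = subst (_≤ q - p) (+-inverseʳ p) (+-monoˡ-≤ (- p) p≤q)

p-q≤p : ∀ p {q} → 0ℚ ≤ q → p - q ≤ p
p-q≤p p {q} q≥0 = subst (p - q ≤_) (+-identityʳ p) (+-monoʳ-≤ p (neg-antimono-≤ q≥0))

*-nonNeg : ∀ {p q} → 0ℚ ≤ p → 0ℚ ≤ q → 0ℚ ≤ p * q
*-nonNeg {p} {q} p≥0 q≥0 =
  nonNegative⁻¹ (p * q) {{nonNeg*nonNeg⇒nonNeg p {{nonNegative p≥0}} q {{nonNegative q≥0}}}}

p+p<q+q⇒p<q : ∀ {p q} → p + p < q + q → p < q
p+p<q+q⇒p<q {p} {q} 2p<2q with p <? q
... | yes p<q = p<q
... | no p≮q = ⊥-elim (<-irrefl refl (<-≤-trans 2p<2q (+-mono-≤ (≮⇒≥ p≮q) (≮⇒≥ p≮q))))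

fromℕ : ℕ → ℚ
fromℕ n = n ×ℕ 1ℚ

fromℕ-+ : ∀ m n → fromℕ (m N.+ n) ≡ fromℕ m + fromℕ n
fromℕ-+ m n = ×-homo-+ 1ℚ m n

fromℕ-* : ∀ m n → fromℕ (m N.* n) ≡ fromℕ m * fromℕ n
fromℕ-* = ×1-homo-*

fromℕ-nonNeg : ∀ n → 0ℚ ≤ fromℕ n
fromℕ-nonNeg N.zero = ≤-refl
fromℕ-nonNeg (suc n) = +-mono-≤ (nonNegative⁻¹ 1ℚ) (fromℕ-nonNeg n)

fromℕ≃mkℚᵘ : ∀ n → toℚᵘ (fromℕ n) ℚᵘ.≃ ℚᵘ.mkℚᵘ (ℤ.+ n) 0
fromℕ≃mkℚᵘ N.zero = ℚᵘ.≃-refl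
fromℕ≃mkℚᵘ (suc n) = begin
  toℚᵘ (1ℚ + fromℕ n)           ≈⟨ toℚᵘ-homo-+ 1ℚ (fromℕ n) ⟩
  ℚᵘ.1ℚᵘ ℚᵘ.+ toℚᵘ (fromℕ n)    ≈⟨ ℚᵘ.+-congʳ ℚᵘ.1ℚᵘ (fromℕ≃mkℚᵘ n) ⟩
  ℚᵘ.1ℚᵘ ℚᵘ.+ ℚᵘ.mkℚᵘ (ℤ.+ n) 0 ≈⟨ ℚᵘ.*≡* (cong (λ z → (ℤ.+ 1 ℤ.+ z) ℤ.* ℤ.+ 1) (ℤ.*-identityʳ (ℤ.+ n))) ⟩
  ℚᵘ.mkℚᵘ (ℤ.+ suc n) 0         ∎
  where open ℚᵘ.≃-Reasoning

archimedean : ∀ p → ∃[ n ] p ≤ fromℕ n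
archimedean (mkℚ (ℤ.+ n) d _) =
  n , toℚᵘ-cancel-≤ (ℚᵘ.≤-respʳ-≃ (ℚᵘ.≃-sym (fromℕ≃mkℚᵘ n)) (ℚᵘ.*≤* n≤n[1+d]))
  where
  n≤n[1+d] : ℤ.+ n ℤ.* ℤ.+ 1 ℤ.≤ ℤ.+ n ℤ.* ℤ.+ suc d
  n≤n[1+d] = ℤ.*-monoˡ-≤-nonNeg (ℤ.+ n) (ℤ.+≤+ (s≤s z≤n))
archimedean (mkℚ ℤ.-[1+ _ ] _ _) = 0 , *≤* ℤ.-≤+

^-nonNeg : ∀ {p} → 0ℚ ≤ p → ∀ n → 0ℚ ≤ p ^ n
^-nonNeg p≥0 N.zero = nonNegative⁻¹ 1ℚ
^-nonNeg p≥0 (suc n) = *-nonNeg p≥0 (^-nonNeg p≥0 n)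

bernoulli : ∀ q → 0ℚ ≤ q → 0ℚ ≤ 1ℚ - q → ∀ n → (1ℚ - q) ^ n * (1ℚ + fromℕ n * q) ≤ 1ℚ
bernoulli q q≥0 1-q≥0 N.zero =
  ≤-reflexive (solve 1 (λ q → con 1ℚ :* (con 1ℚ :+ con 0ℚ :* q) := con 1ℚ) refl q)
bernoulli q q≥0 1-q≥0 (suc n) = begin
  (1ℚ - q) * x * (1ℚ + (1ℚ + i) * q)          ≡⟨ expand ⟩
  x * (1ℚ + i * q) - x * ((1ℚ + i) * (q * q)) ≤⟨ p-q≤p _ loss≥0 ⟩
  x * (1ℚ + i * q)                             ≤⟨ bernoulli q q≥0 1-q≥0 n ⟩
  1ℚ                                           ∎
  where
  open ≤-Reasoning
  x = (1ℚ - q) ^ n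
  i = fromℕ n
  expand : (1ℚ - q) * x * (1ℚ + (1ℚ + i) * q) ≡ x * (1ℚ + i * q) - x * ((1ℚ + i) * (q * q))
  expand = solve 3 (λ q x i → (con 1ℚ :- q) :* x :* (con 1ℚ :+ (con 1ℚ :+ i) :* q)
                              := x :* (con 1ℚ :+ i :* q) :- x :* ((con 1ℚ :+ i) :* (q :* q))) refl q x i
  loss≥0 : 0ℚ ≤ x * ((1ℚ + i) * (q * q))
  loss≥0 = *-nonNeg (^-nonNeg 1-q≥0 n) (*-nonNeg (fromℕ-nonNeg (suc n)) (*-nonNeg q≥0 q≥0))

/'-≢0 : ∀ p q (q≢0 : q ≢ 0ℚ) → p /' q ≡ (p ÷ q) {{≢-nonZero q≢0}}
/'-≢0 p q q≢0 with q ≟ 0ℚ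
... | yes q≡0 = ⊥-elim (q≢0 q≡0)
... | no _ = refl

module _ {s : ℚ} (s≥0 : 0ℚ ≤ s) where
  private
    s+1>0 : 0ℚ < s + 1ℚ
    s+1>0 = subst (_< s + 1ℚ) (+-identityˡ 0ℚ) (+-mono-≤-< s≥0 (positive⁻¹ 1ℚ))
    s+1≢0 : s + 1ℚ ≢ 0ℚ
    s+1≢0 s+1≡0 = <-irrefl (sym s+1≡0) s+1>0
    instance
      s+1-nonZero : NonZero (s + 1ℚ)
      s+1-nonZero = pos⇒nonZero (s + 1ℚ) {{positive s+1>0}}
    w : ℚ
    w = 1/ (s + 1ℚ)
    w≥0 : 0ℚ ≤ w
    w≥0 = <⇒≤ (positive⁻¹ w {{1/pos⇒pos (s + 1ℚ) {{positive s+1>0}}}})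
    w*[s+1]≡1 : w * (s + 1ℚ) ≡ 1ℚ
    w*[s+1]≡1 = *-inverseˡ (s + 1ℚ)
    s*w≡1-w : s * w ≡ 1ℚ - w
    s*w≡1-w = trans (solve 2 (λ s w → s :* w := w :* (s :+ con 1ℚ) :- w) refl s w) (cong (_- w) w*[s+1]≡1)
    s/'[s+1]≡s*w : s /' (s + 1ℚ) ≡ s * w
    s/'[s+1]≡s*w = /'-≢0 s (s + 1ℚ) s+1≢0

  s/'[s+1]-nonNeg : 0ℚ ≤ s /' (s + 1ℚ)
  s/'[s+1]-nonNeg = subst (0ℚ ≤_) (sym s/'[s+1]≡s*w) (*-nonNeg s≥0 w≥0)

  s/'[s+1]≤1 : s /' (s + 1ℚ) ≤ 1ℚ
  s/'[s+1]≤1 = subst (_≤ 1ℚ) (sym (trans s/'[s+1]≡s*w s*w≡1-w)) (p-q≤p 1ℚ w≥0)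

  [1-s/'[s+1]]*[s+1]≡1 : (1ℚ - s /' (s + 1ℚ)) * (s + 1ℚ) ≡ 1ℚ
  [1-s/'[s+1]]*[s+1]≡1 = begin
    (1ℚ - s /' (s + 1ℚ)) * (s + 1ℚ) ≡⟨ cong (λ a → (1ℚ - a) * (s + 1ℚ)) (trans s/'[s+1]≡s*w s*w≡1-w) ⟩
    (1ℚ - (1ℚ - w)) * (s + 1ℚ)      ≡⟨ cong (_* (s + 1ℚ)) (solve 1 (λ w → con 1ℚ :- (con 1ℚ :- w) := w) refl w) ⟩
    w * (s + 1ℚ)                    ≡⟨ w*[s+1]≡1 ⟩
    1ℚ                              ∎
    where open ≡-Reasoning

r[r-1]-nonNeg : ∀ {r} → ¬ r ≤ 1ℚ → 0ℚ ≤ r * (r - 1ℚ)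
r[r-1]-nonNeg {r} r≰1 = *-nonNeg (≤-trans (nonNegative⁻¹ 1ℚ) 1≤r) (p≤q⇒0≤q-p 1≤r)
  where
  1≤r : 1ℚ ≤ r
  1≤r = <⇒≤ (≰⇒> r≰1)

f-nonNeg : ∀ r → 0ℚ ≤ f r
f-nonNeg r with r ≤? 1ℚ
... | yes _ = ≤-refl
... | no r≰1 = s/'[s+1]-nonNeg (r[r-1]-nonNeg r≰1)

f≤1 : ∀ r → f r ≤ 1ℚ
f≤1 r with r ≤? 1ℚ
... | yes _ = nonNegative⁻¹ 1ℚ
... | no r≰1 = s/'[s+1]≤1 (r[r-1]-nonNeg r≰1)

1-f-nonNeg : ∀ r → 0ℚ ≤ 1ℚ - f r
1-f-nonNeg r = p≤q⇒0≤q-p (f≤1 r)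

[1-f]*[r[r-1]+1]≡1 : ∀ r → 1ℚ < r → (1ℚ - f r) * (r * (r - 1ℚ) + 1ℚ) ≡ 1ℚ
[1-f]*[r[r-1]+1]≡1 r 1<r with r ≤? 1ℚ
... | yes r≤1 = ⊥-elim (<-irrefl refl (<-≤-trans 1<r r≤1))
... | no r≰1 = [1-s/'[s+1]]*[s+1]≡1 (r[r-1]-nonNeg r≰1)

module _ {A : Set} (φ : A → ℚ) where

  sumℚ-nonNeg : (∀ x → 0ℚ ≤ φ x) → ∀ xs → 0ℚ ≤ sumℚ (map φ xs)
  sumℚ-nonNeg φ≥0 [] = ≤-refl
  sumℚ-nonNeg φ≥0 (x ∷ xs) = +-mono-≤ (φ≥0 x) (sumℚ-nonNeg φ≥0 xs)

  ∈⇒≤sumℚ : (∀ x → 0ℚ ≤ φ x) → ∀ {x xs} → x ∈ xs → φ x ≤ sumℚ (map φ xs)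
  ∈⇒≤sumℚ φ≥0 {xs = x ∷ xs} (here refl) = p≤p+q (φ x) (sumℚ-nonNeg φ≥0 xs)
  ∈⇒≤sumℚ φ≥0 {xs = y ∷ xs} (there x∈xs) = ≤-trans (∈⇒≤sumℚ φ≥0 x∈xs) (p≤q+p _ (φ≥0 y))

  sumℚ-++ : ∀ xs ys → sumℚ (map φ (xs ++ ys)) ≡ sumℚ (map φ xs) + sumℚ (map φ ys)
  sumℚ-++ [] ys = sym (+-identityˡ _)
  sumℚ-++ (x ∷ xs) ys = trans (cong (φ x +_) (sumℚ-++ xs ys)) (sym (+-assoc (φ x) _ _))

  sumℚ-scale : ∀ c xs → sumℚ (map (λ x → c * φ x) xs) ≡ c * sumℚ (map φ xs)
  sumℚ-scale c [] = sym (*-zeroʳ c)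
  sumℚ-scale c (x ∷ xs) = trans (cong (c * φ x +_) (sumℚ-scale c xs)) (sym (*-distribˡ-+ c (φ x) _))

  ∈⇒≤maxℚ : ∀ {x xs} → x ∈ xs → φ x ≤ maxℚ (map φ xs)
  ∈⇒≤maxℚ {xs = x ∷ xs} (here refl) = p≤p⊔q (φ x) _
  ∈⇒≤maxℚ {xs = y ∷ xs} (there x∈xs) = ≤-trans (∈⇒≤maxℚ x∈xs) (p≤q⊔p (φ y) _)

  maxℚ-lub : ∀ {c} → 0ℚ ≤ c → (∀ x → φ x ≤ c) → ∀ xs → maxℚ (map φ xs) ≤ c
  maxℚ-lub c≥0 φ≤c [] = c≥0
  maxℚ-lub c≥0 φ≤c (x ∷ xs) = ⊔-lub (φ≤c x) (maxℚ-lub c≥0 φ≤c xs)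

  ∈⇒minℚ≤ : ∀ {x xs} → x ∈ xs → minℚ (map φ xs) ≤ φ x
  ∈⇒minℚ≤ {xs = x ∷ xs} (here refl) = foldr-⊓≤init (map φ xs)
    where
    foldr-⊓≤init : ∀ {z} ys → foldr _⊓_ z ys ≤ z
    foldr-⊓≤init [] = ≤-refl
    foldr-⊓≤init (y ∷ ys) = ≤-trans (p⊓q≤q y _) (foldr-⊓≤init ys)
  ∈⇒minℚ≤ {xs = y ∷ xs} (there x∈xs) = foldr-⊓≤∈ (∈-map⁺ φ x∈xs)
    where
    foldr-⊓≤∈ : ∀ {z w ys} → w ∈ ys → foldr _⊓_ z ys ≤ w
    foldr-⊓≤∈ {ys = w ∷ ys} (here refl) = p⊓q≤p w _
    foldr-⊓≤∈ {ys = v ∷ ys} (there w∈ys) = ≤-trans (p⊓q≤q v _) (foldr-⊓≤∈ w∈ys)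

  minℚ-glb : ∀ {c x xs} → x ∈ xs → (∀ y → c ≤ φ y) → c ≤ minℚ (map φ xs)
  minℚ-glb {c} {xs = y ∷ xs} _ c≤φ = foldr-⊓-glb (c≤φ y) (map φ xs) (λ z∈ → c≤φ-map z∈)
    where
    c≤φ-map : ∀ {z} → z ∈ map φ xs → c ≤ z
    c≤φ-map z∈ with ∈-map⁻ φ z∈
    ... | w , _ , refl = c≤φ w
    foldr-⊓-glb : ∀ {z} → c ≤ z → ∀ ys → (∀ {w} → w ∈ ys → c ≤ w) → c ≤ foldr _⊓_ z ys
    foldr-⊓-glb c≤z [] _ = c≤z
    foldr-⊓-glb c≤z (w ∷ ys) c≤ys = ⊓-glb (c≤ys (here refl)) (foldr-⊓-glb c≤z ys (c≤ys ∘ there))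

∈-allVecs : ∀ {A : Set} (xs : List A) {n} (v : Vec A n) → (∀ i → lookup v i ∈ xs) → v ∈ allVecs xs n
∈-allVecs xs [] _ = here refl
∈-allVecs xs (y ∷ v) v⊆xs =
  ∈-concat⁺′ (∈-map⁺ (y ∷_) (∈-allVecs xs v (v⊆xs ∘ suc)))
             (∈-map⁺ (λ x → map (x ∷_) (allVecs xs _)) (v⊆xs zero))

job≤makespan : ∀ {m n} σ c → (∀ j → 0ℚ ≤ c j) → ∀ j → c j ≤ makespan m n σ c
job≤makespan {m} {n} σ c c≥0 j = begin
  c j                                   ≡⟨ cong (λ b → if b then c j else 0ℚ) (sym (dec-true (σ j F.≟ σ j) refl)) ⟩
  share j                               ≤⟨ ∈⇒≤sumℚ share share≥0 (∈-allFin j) ⟩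
  load m n σ c (σ j)                    ≤⟨ ∈⇒≤maxℚ (load m n σ c) (∈-allFin (σ j)) ⟩
  makespan m n σ c                      ∎
  where
  open ≤-Reasoning
  share : Fin n → ℚ
  share k = if does (σ k F.≟ σ j) then c k else 0ℚ
  share≥0 : ∀ k → 0ℚ ≤ share k
  share≥0 k with does (σ k F.≟ σ j)
  ... | true = c≥0 k
  ... | false = ≤-refl

makespan-cong : ∀ {m n σ τ} c → (∀ j → σ j ≡ τ j) → makespan m n σ c ≡ makespan m n τ c
makespan-cong {m} {n} c σ≗τ = cong maxℚ (map-cong (λ i → cong sumℚ (map-cong
  (λ j → cong (λ k → if does (k F.≟ i) then c j else 0ℚ) (σ≗τ j)) (allFin n))) (allFin m))

load-id : ∀ {n} c (i : Fin n) → load n n (λ j → j) c i ≡ c i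
load-id {n} c i = trans (cong sumℚ (map-tabulate (λ j → j) indicator)) (sum-indicator i c)
  where
  indicator : Fin n → ℚ
  indicator j = if does (j F.≟ i) then c j else 0ℚ
  sum-zeros : ∀ k → sumℚ (tabulate {n = k} (λ _ → 0ℚ)) ≡ 0ℚ
  sum-zeros N.zero = refl
  sum-zeros (suc k) = trans (cong (0ℚ +_) (sum-zeros k)) (+-identityˡ 0ℚ)
  sum-indicator : ∀ {k} (i : Fin k) c → sumℚ (tabulate (λ j → if does (j F.≟ i) then c j else 0ℚ)) ≡ c i
  sum-indicator {suc k} zero c = trans (cong (c zero +_) (sum-zeros k)) (+-identityʳ _)
  sum-indicator (suc i) c = trans (cong (0ℚ +_) (sum-indicator i (λ j → c (suc j)))) (+-identityˡ _)

Copt≤makespan : ∀ {m n} u p σ → Copt m n u p ≤ makespan m n σ (ρ u p)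
Copt≤makespan {m} {n} u p σ = begin
  Copt m n u p                                        ≤⟨ ∈⇒minℚ≤ C (∈-allVecs (allFin m) (V.tabulate σ) (λ _ → ∈-allFin _)) ⟩
  makespan m n (lookup (V.tabulate σ)) (ρ u p)        ≡⟨ makespan-cong (ρ u p) (lookup∘tabulate σ) ⟩
  makespan m n σ (ρ u p)                              ∎
  where
  open ≤-Reasoning
  C : Vec (Fin m) n → ℚ
  C v = makespan m n (lookup v) (ρ u p)

≤Copt : ∀ {m n c} u p → Fin m → (∀ σ → c ≤ makespan m n σ (ρ u p)) → c ≤ Copt m n u p
≤Copt {m} {n} u p i c≤C =
  minℚ-glb (λ v → makespan m n (lookup v) (ρ u p))
           (∈-allVecs (allFin m) (replicate n i) (λ _ → ∈-allFin _)) (c≤C ∘ lookup)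

Copt-unitJobs : ∀ {n} u p → (∀ j → ρ u p j ≡ 1ℚ) → Copt (suc n) (suc n) u p ≡ 1ℚ
Copt-unitJobs {n} u p ρ≡1 = ≤-antisym Copt≤1 1≤Copt
  where
  Copt≤1 : Copt (suc n) (suc n) u p ≤ 1ℚ
  Copt≤1 = ≤-trans (Copt≤makespan u p (λ j → j))
    (maxℚ-lub (load (suc n) (suc n) (λ j → j) (ρ u p)) (nonNegative⁻¹ 1ℚ)
              (λ i → ≤-reflexive (trans (load-id (ρ u p) i) (ρ≡1 i))) (allFin (suc n)))
  ρ≥0 : ∀ j → 0ℚ ≤ ρ u p j
  ρ≥0 j = subst (0ℚ ≤_) (sym (ρ≡1 j)) (nonNegative⁻¹ 1ℚ)
  1≤Copt : 1ℚ ≤ Copt (suc n) (suc n) u p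
  1≤Copt = ≤Copt u p zero (λ σ → subst (_≤ makespan (suc n) (suc n) σ (ρ u p)) (ρ≡1 zero)
                                       (job≤makespan σ (ρ u p) ρ≥0 zero))

-- ExpC m n u p σ unfolds to expect u (λ b → makespan m n (σ b) (occ u p b)).
expect : ∀ {n} → Vec ℚ n → (Vec Bool n → ℚ) → ℚ
expect {n} u g = sumℚ (map (λ b → prob u b * g b) (allVecs allBool n))

expect-∷ : ∀ {n} x (u : Vec ℚ n) g →
  expect (x ∷ u) g ≡ f x * expect u (λ b → g (true ∷ b)) + (1ℚ - f x) * expect u (λ b → g (false ∷ b))
expect-∷ {n} x u g = begin
  expect (x ∷ u) g
    ≡⟨ sumℚ-++ φ (branch true) _ ⟩
  sumℚ (map φ (branch true)) + sumℚ (map φ (branch false ++ []))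
    ≡⟨ cong (λ l → sumℚ (map φ (branch true)) + sumℚ (map φ l)) (++-identityʳ (branch false)) ⟩
  sumℚ (map φ (branch true)) + sumℚ (map φ (branch false))
    ≡⟨ cong₂ _+_ (sum-branch true) (sum-branch false) ⟩
  f x * expect u (λ b → g (true ∷ b)) + (1ℚ - f x) * expect u (λ b → g (false ∷ b)) ∎
  where
  open ≡-Reasoning
  L = allVecs allBool n
  φ : Vec Bool (suc n) → ℚ
  φ b = prob (x ∷ u) b * g b
  branch : Bool → List (Vec Bool (suc n))
  branch t = map (t ∷_) L
  sum-branch : ∀ t → sumℚ (map φ (branch t)) ≡ (if t then f x else 1ℚ - f x) * expect u (λ b → g (t ∷ b))
  sum-branch t = begin
    sumℚ (map φ (map (t ∷_) L))                     ≡⟨ cong sumℚ (sym (map-∘ L)) ⟩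
    sumℚ (map (λ b → w * prob u b * g (t ∷ b)) L)   ≡⟨ cong sumℚ (map-cong (λ b → *-assoc w (prob u b) _) L) ⟩
    sumℚ (map (λ b → w * (prob u b * g (t ∷ b))) L) ≡⟨ sumℚ-scale (λ b → prob u b * g (t ∷ b)) w L ⟩
    w * expect u (λ b → g (t ∷ b))                  ∎
    where
    w = if t then f x else 1ℚ - f x

expect-mono : ∀ {n} (u : Vec ℚ n) {g h} → (∀ b → g b ≤ h b) → expect u g ≤ expect u h
expect-mono [] g≤h = +-monoˡ-≤ 0ℚ (*-monoˡ-≤-nonNeg 1ℚ (g≤h []))
expect-mono (x ∷ u) {g} {h} g≤h = begin
  expect (x ∷ u) g
    ≡⟨ expect-∷ x u g ⟩
  f x * expect u (λ b → g (true ∷ b)) + (1ℚ - f x) * expect u (λ b → g (false ∷ b))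
    ≤⟨ +-mono-≤ (weighted (f-nonNeg x) true) (weighted (1-f-nonNeg x) false) ⟩
  f x * expect u (λ b → h (true ∷ b)) + (1ℚ - f x) * expect u (λ b → h (false ∷ b))
    ≡⟨ expect-∷ x u h ⟨
  expect (x ∷ u) h ∎
  where
  open ≤-Reasoning
  weighted : ∀ {w} → 0ℚ ≤ w → ∀ t → w * expect u (λ b → g (t ∷ b)) ≤ w * expect u (λ b → h (t ∷ b))
  weighted {w} w≥0 t = *-monoˡ-≤-nonNeg w {{nonNegative w≥0}} (expect-mono u (λ b → g≤h (t ∷ b)))

expect-const : ∀ {n} (u : Vec ℚ n) c → expect u (λ _ → c) ≡ c
expect-const [] c = solve 1 (λ c → con 1ℚ :* c :+ con 0ℚ := c) refl c
expect-const (x ∷ u) c = begin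
  expect (x ∷ u) (λ _ → c)
    ≡⟨ expect-∷ x u (λ _ → c) ⟩
  f x * expect u (λ _ → c) + (1ℚ - f x) * expect u (λ _ → c)
    ≡⟨ cong (λ e → f x * e + (1ℚ - f x) * e) (expect-const u c) ⟩
  f x * c + (1ℚ - f x) * c
    ≡⟨ solve 2 (λ a c → a :* c :+ (con 1ℚ :- a) :* c := c) refl (f x) c ⟩
  c ∎
  where open ≡-Reasoning

allTrue : ∀ {n} → Vec Bool n → Bool
allTrue [] = true
allTrue (b ∷ bs) = b ∧ allTrue bs

expect-allTrue : ∀ n r x y → expect (replicate n r) (λ b → if allTrue b then x else y) ≡ y - (y - x) * f r ^ n
expect-allTrue N.zero r x y = solve 2 (λ x y → con 1ℚ :* x :+ con 0ℚ := y :- (y :- x) :* con 1ℚ) refl x y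
expect-allTrue (suc n) r x y = begin
  expect (replicate (suc n) r) G
    ≡⟨ expect-∷ r (replicate n r) G ⟩
  f r * expect (replicate n r) G + (1ℚ - f r) * expect (replicate n r) (λ _ → y)
    ≡⟨ cong₂ (λ e e′ → f r * e + (1ℚ - f r) * e′) (expect-allTrue n r x y) (expect-const (replicate n r) y) ⟩
  f r * (y - (y - x) * f r ^ n) + (1ℚ - f r) * y
    ≡⟨ solve 4 (λ a x y t → a :* (y :- (y :- x) :* t) :+ (con 1ℚ :- a) :* y := y :- (y :- x) :* (a :* t))
               refl (f r) x y (f r ^ n) ⟩
  y - (y - x) * f r ^ suc n ∎
  where
  open ≡-Reasoning
  G : ∀ {k} → Vec Bool k → ℚ
  G b = if allTrue b then x else y

untested-job : ∀ {n} (b : Vec Bool n) → allTrue b ≡ false → ∃[ j ] lookup b j ≡ false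
untested-job (true ∷ bs) all≡false with untested-job bs all≡false
... | j , bj≡false = suc j , bj≡false
untested-job (false ∷ bs) _ = zero , refl

module _ {n : ℕ} {r : ℚ} (1≤r : 1ℚ ≤ r) where

  private
    u p : Vec ℚ (suc n)
    u = replicate (suc n) r
    p = replicate (suc n) 0ℚ

  ρ-replicate : ∀ j → ρ u p j ≡ 1ℚ
  ρ-replicate j = begin
    lookup u j ⊓ (1ℚ + lookup p j) ≡⟨ cong₂ (λ a b → a ⊓ (1ℚ + b)) (lookup-replicate j r) (lookup-replicate j 0ℚ) ⟩
    r ⊓ (1ℚ + 0ℚ)                  ≡⟨ p≥q⇒p⊓q≡q 1≤r ⟩
    1ℚ                             ∎
    where open ≡-Reasoning

  occ-replicate : ∀ b j → occ u p b j ≡ (if lookup b j then 1ℚ else r)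
  occ-replicate b j = begin
    (if lookup b j then 1ℚ + lookup p j else lookup u j) ≡⟨ cong₂ (λ a c → if lookup b j then 1ℚ + a else c)
                                                                 (lookup-replicate j 0ℚ) (lookup-replicate j r) ⟩
    (if lookup b j then 1ℚ + 0ℚ else r)                  ≡⟨ cong (λ a → if lookup b j then a else r) (+-identityʳ 1ℚ) ⟩
    (if lookup b j then 1ℚ else r)                       ∎
    where open ≡-Reasoning

  occ-replicate≥1 : ∀ b j → 1ℚ ≤ occ u p b j
  occ-replicate≥1 b j with lookup b j | occ-replicate b j
  ... | true  | occ≡1 = ≤-reflexive (sym occ≡1)
  ... | false | occ≡r = subst (1ℚ ≤_) (sym occ≡r) 1≤r

  occ-replicate-nonNeg : ∀ b j → 0ℚ ≤ occ u p b j
  occ-replicate-nonNeg b j = ≤-trans (nonNegative⁻¹ 1ℚ) (occ-replicate≥1 b j)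

  allTested-or-r≤makespan : ∀ {m} σ b → (if allTrue b then 1ℚ else r) ≤ makespan m (suc n) σ (occ u p b)
  allTested-or-r≤makespan σ b with allTrue b in all≡
  ... | true = ≤-trans (occ-replicate≥1 b zero) (job≤makespan σ (occ u p b) (occ-replicate-nonNeg b) zero)
  ... | false with untested-job b all≡
  ...   | j , bj≡false = subst (_≤ _) (trans (occ-replicate b j) (cong (λ t → if t then 1ℚ else r) bj≡false))
                                      (job≤makespan σ (occ u p b) (occ-replicate-nonNeg b) j)

  ExpC-replicate-≥ : ∀ {m} σ → r - (r - 1ℚ) * f r ^ suc n ≤ ExpC m (suc n) u p σ
  ExpC-replicate-≥ σ = begin
    r - (r - 1ℚ) * f r ^ suc n                       ≡⟨ expect-allTrue (suc n) r 1ℚ r ⟨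
    expect u (λ b → if allTrue b then 1ℚ else r)     ≤⟨ expect-mono u (λ b → allTested-or-r≤makespan (σ b) b) ⟩
    ExpC _ (suc n) u p σ                              ∎
    where open ≤-Reasoning

module HardInstance (k : ℕ) where

  r : ℚ
  r = fromℕ (suc (suc k))

  N : ℕ
  N = suc (suc (suc k) N.* suc k)

  u p : Vec ℚ N
  u = replicate N r
  p = replicate N 0ℚ

  1<r : 1ℚ < r
  1<r = subst (_< r) (+-identityʳ 1ℚ) (+-monoʳ-< 1ℚ (<-≤-trans (positive⁻¹ 1ℚ) (p≤p+q 1ℚ (fromℕ-nonNeg k))))

  r-1≥0 : 0ℚ ≤ r - 1ℚ
  r-1≥0 = p≤q⇒0≤q-p (<⇒≤ 1<r)

  fromℕ-N : fromℕ N ≡ r * (r - 1ℚ) + 1ℚ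
  fromℕ-N = begin
    1ℚ + fromℕ (suc (suc k) N.* suc k)    ≡⟨ cong (1ℚ +_) (fromℕ-* (suc (suc k)) (suc k)) ⟩
    1ℚ + r * fromℕ (suc k)                ≡⟨ solve 1 (λ x → con 1ℚ :+ (con 1ℚ :+ (con 1ℚ :+ x)) :* (con 1ℚ :+ x)
                                                          := (con 1ℚ :+ (con 1ℚ :+ x)) :* ((con 1ℚ :+ (con 1ℚ :+ x)) :- con 1ℚ) :+ con 1ℚ)
                                                   refl (fromℕ k) ⟩
    r * (r - 1ℚ) + 1ℚ                     ∎
    where open ≡-Reasoning

  allTested-unlikely : f r ^ N + f r ^ N ≤ 1ℚ
  allTested-unlikely = begin
    f r ^ N + f r ^ N                                   ≡⟨ solve 1 (λ a → a :+ a := a :* (con 1ℚ :+ con 1ℚ)) refl (f r ^ N) ⟩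
    f r ^ N * (1ℚ + 1ℚ)                                 ≡⟨ cong₂ (λ a b → a ^ N * (1ℚ + b)) f≡1-q (sym N*q≡1) ⟩
    (1ℚ - q) ^ N * (1ℚ + fromℕ N * q)                   ≤⟨ bernoulli q (1-f-nonNeg r) (subst (0ℚ ≤_) f≡1-q (f-nonNeg r)) N ⟩
    1ℚ                                                  ∎
    where
    open ≤-Reasoning
    q = 1ℚ - f r
    f≡1-q : f r ≡ 1ℚ - q
    f≡1-q = solve 1 (λ a → a := con 1ℚ :- (con 1ℚ :- a)) refl (f r)
    N*q≡1 : fromℕ N * q ≡ 1ℚ
    N*q≡1 = trans (cong (_* q) fromℕ-N) (trans (*-comm _ q) ([1-f]*[r[r-1]+1]≡1 r 1<r))

  Copt≡1 : Copt N N u p ≡ 1ℚ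
  Copt≡1 = Copt-unitJobs u p (ρ-replicate (<⇒≤ 1<r))

  p-bounds : ∀ j → (0ℚ ≤ lookup p j) × (lookup p j ≤ lookup u j)
  p-bounds j = subst (0ℚ ≤_) (sym p≡0) ≤-refl
             , subst₂ _≤_ (sym p≡0) (sym (lookup-replicate j r)) (fromℕ-nonNeg (suc (suc k)))
    where
    p≡0 = lookup-replicate j 0ℚ

  k<1+r : fromℕ k < 1ℚ + r
  k<1+r = begin-strict
    fromℕ k                    ≡⟨ +-identityˡ (fromℕ k) ⟨
    0ℚ + fromℕ k               <⟨ +-monoˡ-< (fromℕ k) (positive⁻¹ (1ℚ + (1ℚ + 1ℚ))) ⟩
    (1ℚ + (1ℚ + 1ℚ)) + fromℕ k ≡⟨ solve 1 (λ x → (con 1ℚ :+ (con 1ℚ :+ con 1ℚ)) :+ x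
                                              := con 1ℚ :+ (con 1ℚ :+ (con 1ℚ :+ x))) refl (fromℕ k) ⟩
    1ℚ + r                     ∎
    where open ≤-Reasoning

  1+r≤ExpC+ExpC : ∀ σ → 1ℚ + r ≤ ExpC N N u p σ + ExpC N N u p σ
  1+r≤ExpC+ExpC σ = begin
    1ℚ + r                                   ≡⟨ solve 1 (λ r → con 1ℚ :+ r := (r :+ r) :- (r :- con 1ℚ) :* con 1ℚ) refl r ⟩
    (r + r) - (r - 1ℚ) * 1ℚ                  ≤⟨ +-monoʳ-≤ (r + r) (neg-antimono-≤
                                                  (*-monoˡ-≤-nonNeg (r - 1ℚ) {{nonNegative r-1≥0}} allTested-unlikely)) ⟩
    (r + r) - (r - 1ℚ) * (a + a)             ≡⟨ solve 2 (λ r a → (r :+ r) :- (r :- con 1ℚ) :* (a :+ a)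
                                                    := (r :- (r :- con 1ℚ) :* a) :+ (r :- (r :- con 1ℚ) :* a)) refl r a ⟩
    (r - (r - 1ℚ) * a) + (r - (r - 1ℚ) * a)  ≤⟨ +-mono-≤ (ExpC-replicate-≥ (<⇒≤ 1<r) σ) (ExpC-replicate-≥ (<⇒≤ 1<r) σ) ⟩
    ExpC N N u p σ + ExpC N N u p σ          ∎
    where
    open ≤-Reasoning
    a = f r ^ N

lemma1 : (K : ℚ) → 0ℚ < K →
    ∃[ m ] ∃[ n ] Σ (Vec ℚ n) λ u → Σ (Vec ℚ n) λ p →
      (1 N.≤ m)
      × ((j : Fin n) → (0ℚ ≤ lookup p j) × (lookup p j ≤ lookup u j))
      × (0ℚ < Copt m n u p)
      × ((σ : Vec Bool n → Fin n → Fin m) → K * Copt m n u p < ExpC m n u p σ)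
lemma1 K _ with archimedean K
... | A , K≤A = N , N , u , p , s≤s z≤n , p-bounds , Copt>0 , K*Copt<ExpC
  where
  open HardInstance (A N.+ A)
  Copt>0 : 0ℚ < Copt N N u p
  Copt>0 = subst (0ℚ <_) (sym Copt≡1) (positive⁻¹ 1ℚ)
  K*Copt<ExpC : ∀ σ → K * Copt N N u p < ExpC N N u p σ
  K*Copt<ExpC σ = subst (_< ExpC N N u p σ) (sym (trans (cong (K *_) Copt≡1) (*-identityʳ K)))
    (p+p<q+q⇒p<q (begin-strict
      K + K                           ≤⟨ +-mono-≤ K≤A K≤A ⟩
      fromℕ A + fromℕ A               ≡⟨ fromℕ-+ A A ⟨
      fromℕ (A N.+ A)                 <⟨ k<1+r ⟩
      1ℚ + r                          ≤⟨ 1+r≤ExpC+ExpC σ ⟩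
      ExpC N N u p σ + ExpC N N u p σ ∎))
    where open ≤-Reasoning
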